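{- Every $\langle 2,2\rangle$ CCE graph has only path components and cycle components (isolated vertices being counted as trivial paths).
   Context: All graphs and digraphs are simple (no loops, no multiple arcs). In a digraph $D$, if $(u,x)$ is an arc then $x$ is a prey of $u$ and $u$ is a predator of $x$. The CCE graph $CCE(D)$ of a digraph $D$ is the graph on $V(D)$ in which distinct $u,v$ are adjacent iff they have a common prey and a common predator in $D$. A $\langle 2,2\rangle$ digraph is a digraph in which every vertex has indegree at most $2$ and outdegree at most $2$; a $\langle 2,2\rangle$ CCE graph is the CCE graph of some $\langle 2,2\rangle$ digraph. -}

module Defs where

open import Data.Nat using (ℕ; zero; suc; _+_; _≤_)
open import Data.Fin using (Fin; toℕ)
import Data.Fin as F
open import Data.Bool using (Bool; true; false; if_then_else_)
open import Data.Product using (Σ; ∃; _×_; _,_)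
open import Data.Sum using (_⊎_)
open import Relation.Binary.PropositionalEquality using (_≡_; _≢_)
open import Function using (_∘_; _⇔_; Injective)

countTrue : ∀ {n} → (Fin n → Bool) → ℕ
countTrue {zero}  f = 0
countTrue {suc n} f = (if f F.zero then 1 else 0) + countTrue (f ∘ F.suc)

-- a simple digraph on vertex set Fin n: an arc relation with no loops
-- (multiple arcs are impossible with a Boolean relation)
record Digraph (n : ℕ) : Set where
  field
    arc     : Fin n → Fin n → Bool
    loopless : ∀ u → arc u u ≡ false
open Digraph public

outdeg indeg : ∀ {n} → Digraph n → Fin n → ℕ
outdeg D u = countTrue (λ x → arc D u x)
indeg  D x = countTrue (λ u → arc D u x)

Is22 : ∀ {n} → Digraph n → Set
Is22 {n} D = ∀ (v : Fin n) → indeg D v ≤ 2 × outdeg D v ≤ 2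

Graph : ℕ → Set₁
Graph n = Fin n → Fin n → Set

-- the CCE graph: distinct u, v adjacent iff common prey and common predator
CCE : ∀ {n} → Digraph n → Graph n
CCE D u v =
  u ≢ v
  × (∃ λ w → arc D u w ≡ true × arc D v w ≡ true)
  × (∃ λ z → arc D z u ≡ true × arc D z v ≡ true)

data Reach {n : ℕ} (G : Graph n) : Fin n → Fin n → Set where
  here : ∀ {u} → Reach G u u
  step : ∀ {u v w} → G u v → Reach G v w → Reach G u w

Consec : ∀ {m} → Fin m → Fin m → Set
Consec i j = toℕ j ≡ suc (toℕ i) ⊎ toℕ i ≡ suc (toℕ j)

Closing : ∀ {k} → Fin (suc k) → Fin (suc k) → Set
Closing {k} i j = (toℕ i ≡ 0 × toℕ j ≡ k) ⊎ (toℕ i ≡ k × toℕ j ≡ 0)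

EnumeratesComponent : ∀ {n k} → Graph n → Fin n → (Fin (suc k) → Fin n) → Set
EnumeratesComponent G v f =
  Injective _≡_ _≡_ f × (∀ u → Reach G v u ⇔ (∃ λ i → f i ≡ u))

-- the component of v is a path v₀ … v_k (k = 0: isolated vertex, trivial path):
-- the edges inside it are exactly the consecutive pairs
ComponentIsPath : ∀ {n} → Graph n → Fin n → Set
ComponentIsPath {n} G v =
  Σ ℕ λ k → Σ (Fin (suc k) → Fin n) λ f →
    EnumeratesComponent G v f × (∀ i j → G (f i) (f j) ⇔ Consec i j)

-- the component of v is a cycle v₀ … v_k v₀ with k ≥ 2 (at least 3 vertices)
ComponentIsCycle : ∀ {n} → Graph n → Fin n → Set
ComponentIsCycle {n} G v =
  Σ ℕ λ k → 2 ≤ k × Σ (Fin (suc k) → Fin n) λ f →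
    EnumeratesComponent G v f × (∀ i j → G (f i) (f j) ⇔ (Consec i j ⊎ Closing i j))

-- In a ⟨2,2⟩ digraph, a vertex u adjacent in the CCE graph to three
-- distinct a, b, c has, by outdegree ≤ 2, one prey w shared with two of
-- them, say a and b; then u, a and b are three distinct predators of w,
-- contradicting indegree ≤ 2.  So the CCE graph has maximum degree 2, and
-- in a finite graph of maximum degree 2 a path that cannot be extended at
-- either end spans a whole component: its inner vertices already have both
-- of their neighbours on it, so the only edge it may miss joins its two
-- ends, which makes the component a cycle.
module Submission where

open import Defs
open import Data.Nat using (ℕ; zero; suc; _+_; _∸_; _≤_; _<_; z≤n; s≤s; _≤?_)
open import Data.Nat.Properties
  using (≤-trans; ≤-pred; <-irrefl; ≰⇒>; ≤∧≢⇒<; +-suc; +-∸-assoc; n∸n≡0; m≤m+n; m≢1+n+m)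
  renaming (_≟_ to _≟ℕ_)
import Data.Nat.Properties as ℕₚ
open import Data.Fin using (Fin; zero; suc; toℕ; fromℕ; fromℕ<; inject₁; opposite; punchIn; punchOut)
open import Data.Fin.Properties
  using (_≟_; toℕ-injective; toℕ-fromℕ; toℕ-fromℕ<; toℕ-inject₁; toℕ<n; 0≢1+n; any?;
         punchIn-punchOut; punchOut-injective; suc-injective; injective⇒≤; opposite-prop; opposite-involutive)
open import Data.Bool using (Bool; true; if_then_else_)
open import Data.Bool.Properties using () renaming (_≟_ to _≟ᵇ_)
open import Data.Product using (Σ; ∃; _×_; _,_; proj₁; proj₂)
open import Data.Sum using (_⊎_; inj₁; inj₂; [_,_]; swap)
open import Data.Empty using (⊥-elim)
open import Relation.Nullary using (yes; no)
open import Relation.Nullary.Decidable using (_×-dec_; ¬?; decidable-stable)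
open import Relation.Binary.Definitions using (Decidable; Symmetric; Irreflexive)
open import Relation.Binary.PropositionalEquality
  using (_≡_; _≢_; refl; sym; trans; cong; subst; module ≡-Reasoning)
open import Function using (_∘_; _⇔_; Injective; mk⇔; Equivalence)

countTrue-punchIn : ∀ {m} (g : Fin (suc m) → Bool) {x} → g x ≡ true →
                    countTrue g ≡ suc (countTrue (g ∘ punchIn x))
countTrue-punchIn g {zero} gx rewrite gx = refl
countTrue-punchIn {suc m} g {suc x} gx =
  trans (cong (b +_) (countTrue-punchIn (g ∘ suc) gx)) (+-suc b _)
  where b = if g zero then 1 else 0

injective⇒≤countTrue : ∀ {k m} (g : Fin m → Bool) (xs : Fin k → Fin m) →
                       Injective _≡_ _≡_ xs → (∀ i → g (xs i) ≡ true) → k ≤ countTrue g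
injective⇒≤countTrue {zero} g xs _ _ = z≤n
injective⇒≤countTrue {suc k} {zero} g xs _ _ with xs zero
... | ()
injective⇒≤countTrue {suc k} {suc m} g xs xs-inj xs-true =
  subst (suc k ≤_) (sym (countTrue-punchIn g (xs-true zero)))
        (s≤s (injective⇒≤countTrue (g ∘ punchIn (xs zero)) ys ys-inj ys-true))
  where
  head≢ : ∀ i → xs zero ≢ xs (suc i)
  head≢ i = 0≢1+n ∘ xs-inj
  ys : Fin k → Fin m
  ys i = punchOut (head≢ i)
  ys-inj : Injective _≡_ _≡_ ys
  ys-inj {i} {j} e = suc-injective (xs-inj (punchOut-injective (head≢ i) (head≢ j) e))
  ys-true : ∀ i → g (punchIn (xs zero) (ys i)) ≡ true
  ys-true i = trans (cong g (punchIn-punchOut (head≢ i))) (xs-true (suc i))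

countTrue≤2⇒collision : ∀ {m} (g : Fin m → Bool) {x y z} → countTrue g ≤ 2 →
                        g x ≡ true → g y ≡ true → g z ≡ true → x ≡ y ⊎ x ≡ z ⊎ y ≡ z
countTrue≤2⇒collision g {x} {y} {z} count≤2 gx gy gz with x ≟ y | x ≟ z | y ≟ z
... | yes x≡y | _       | _       = inj₁ x≡y
... | no _    | yes x≡z | _       = inj₂ (inj₁ x≡z)
... | no _    | no _    | yes y≡z = inj₂ (inj₂ y≡z)
... | no x≢y  | no x≢z  | no y≢z  =
  ⊥-elim (<-irrefl refl (≤-trans (injective⇒≤countTrue g xyz xyz-inj xyz-true) count≤2))
  where
  xyz : Fin 3 → Fin _
  xyz zero = x
  xyz (suc zero) = y
  xyz (suc (suc zero)) = z
  xyz-true : ∀ i → g (xyz i) ≡ true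
  xyz-true zero = gx
  xyz-true (suc zero) = gy
  xyz-true (suc (suc zero)) = gz
  xyz-inj : Injective _≡_ _≡_ xyz
  xyz-inj {zero}             {zero}             _ = refl
  xyz-inj {zero}             {suc zero}         e = ⊥-elim (x≢y e)
  xyz-inj {zero}             {suc (suc zero)}   e = ⊥-elim (x≢z e)
  xyz-inj {suc zero}         {zero}             e = ⊥-elim (x≢y (sym e))
  xyz-inj {suc zero}         {suc zero}         _ = refl
  xyz-inj {suc zero}         {suc (suc zero)}   e = ⊥-elim (y≢z e)
  xyz-inj {suc (suc zero)}   {zero}             e = ⊥-elim (x≢z (sym e))
  xyz-inj {suc (suc zero)}   {suc zero}         e = ⊥-elim (y≢z (sym e))
  xyz-inj {suc (suc zero)}   {suc (suc zero)}   _ = refl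

MaxDegree≤2 : ∀ {n} → Graph n → Set
MaxDegree≤2 G = ∀ {u a b c} → G u a → G u b → G u c → a ≡ b ⊎ a ≡ c ⊎ b ≡ c

module _ {n : ℕ} (D : Digraph n) where

  CCE? : Decidable (CCE D)
  CCE? u v = ¬? (u ≟ v)
    ×-dec any? (λ w → (arc D u w ≟ᵇ true) ×-dec (arc D v w ≟ᵇ true))
    ×-dec any? (λ z → (arc D z u ≟ᵇ true) ×-dec (arc D z v ≟ᵇ true))

  CCE-sym : Symmetric (CCE D)
  CCE-sym (u≢v , (w , uw , vw) , (z , zu , zv)) = u≢v ∘ sym , (w , vw , uw) , (z , zv , zu)

  CCE-irrefl : Irreflexive _≡_ (CCE D)
  CCE-irrefl refl (u≢u , _) = u≢u refl

  module _ (D-22 : Is22 D) where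

    shared-prey⇒≡ : ∀ {u a b w} → u ≢ a → u ≢ b →
                   arc D u w ≡ true → arc D a w ≡ true → arc D b w ≡ true → a ≡ b
    shared-prey⇒≡ {w = w} u≢a u≢b uw aw bw
      with countTrue≤2⇒collision (λ z → arc D z w) (proj₁ (D-22 w)) uw aw bw
    ... | inj₁ u≡a         = ⊥-elim (u≢a u≡a)
    ... | inj₂ (inj₁ u≡b)  = ⊥-elim (u≢b u≡b)
    ... | inj₂ (inj₂ a≡b)  = a≡b

    CCE-maxDegree≤2 : MaxDegree≤2 (CCE D)
    CCE-maxDegree≤2 {u} (u≢a , (wa , uwa , awa) , _) (u≢b , (wb , uwb , bwb) , _)
                        (u≢c , (wc , uwc , cwc) , _)
      with countTrue≤2⇒collision (arc D u) (proj₂ (D-22 u)) uwa uwb uwc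
    ... | inj₁ refl        = inj₁ (shared-prey⇒≡ u≢a u≢b uwa awa bwb)
    ... | inj₂ (inj₁ refl) = inj₂ (inj₁ (shared-prey⇒≡ u≢a u≢c uwa awa cwc))
    ... | inj₂ (inj₂ refl) = inj₂ (inj₂ (shared-prey⇒≡ u≢b u≢c uwb bwb cwc))

toℕ≡⇒≡fromℕ : ∀ {k} {i : Fin (suc k)} → toℕ i ≡ k → i ≡ fromℕ k
toℕ≡⇒≡fromℕ {k} i≡k = toℕ-injective (trans i≡k (sym (toℕ-fromℕ k)))

opposite-fromℕ : ∀ k → opposite (fromℕ k) ≡ zero
opposite-fromℕ k = toℕ-injective (begin
  toℕ (opposite (fromℕ k)) ≡⟨ opposite-prop (fromℕ k) ⟩
  k ∸ toℕ (fromℕ k)        ≡⟨ cong (k ∸_) (toℕ-fromℕ k) ⟩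
  k ∸ k                    ≡⟨ n∸n≡0 k ⟩
  0                        ∎)
  where open ≡-Reasoning

Succ : ∀ {m} → Fin m → Fin m → Set
Succ i j = toℕ j ≡ suc (toℕ i)

opposite-Succ : ∀ {k} {i j : Fin (suc k)} → Succ i j → Succ (opposite j) (opposite i)
opposite-Succ {k} {i} {j} i→j = begin
  toℕ (opposite i)      ≡⟨ opposite-prop i ⟩
  k ∸ toℕ i             ≡⟨ +-∸-assoc 1 1+i≤k ⟩
  suc (k ∸ suc (toℕ i)) ≡⟨ cong (λ t → suc (k ∸ t)) (sym i→j) ⟩
  suc (k ∸ toℕ j)       ≡⟨ cong suc (opposite-prop j) ⟨
  suc (toℕ (opposite j)) ∎
  where
  open ≡-Reasoning
  1+i≤k : suc (toℕ i) ≤ k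
  1+i≤k = subst (_≤ k) i→j (≤-pred (toℕ<n j))

Closing⇒Consec : ∀ {k} {i j : Fin (suc k)} → k < 2 → i ≢ j → Closing i j → Consec i j
Closing⇒Consec {zero} {zero} {zero} _ i≢j _ = ⊥-elim (i≢j refl)
Closing⇒Consec {suc zero} _ _ (inj₁ (i≡0 , j≡1)) = inj₁ (trans j≡1 (cong suc (sym i≡0)))
Closing⇒Consec {suc zero} _ _ (inj₂ (i≡1 , j≡0)) = inj₂ (trans i≡1 (cong suc (sym j≡0)))
Closing⇒Consec {suc (suc k)} (s≤s (s≤s ()))

Closing⇒endpoints : ∀ {k} {i j : Fin (suc k)} → Closing i j →
                    (i ≡ zero × j ≡ fromℕ k) ⊎ (i ≡ fromℕ k × j ≡ zero)
Closing⇒endpoints (inj₁ (i≡0 , j≡k)) = inj₁ (toℕ-injective i≡0 , toℕ≡⇒≡fromℕ j≡k)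
Closing⇒endpoints (inj₂ (i≡k , j≡0)) = inj₂ (toℕ≡⇒≡fromℕ i≡k , toℕ-injective j≡0)

data Position {k : ℕ} (i : Fin (suc k)) : Set where
  first : i ≡ zero → Position i
  final : i ≡ fromℕ k → Position i
  inner : ∀ i⁻ i⁺ → Succ i⁻ i → Succ i i⁺ → Position i

position : ∀ {k} (i : Fin (suc k)) → Position i
position zero = first refl
position {k} (suc i) with suc (toℕ i) ≟ℕ k
... | yes 1+i≡k = final (toℕ≡⇒≡fromℕ 1+i≡k)
... | no 1+i≢k  = inner (inject₁ i) (fromℕ< 2+i<1+k) (cong suc (sym (toℕ-inject₁ i))) (toℕ-fromℕ< 2+i<1+k)
  where
  2+i<1+k : suc (suc (toℕ i)) < suc k
  2+i<1+k = s≤s (≤∧≢⇒< (toℕ<n i) 1+i≢k)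

module MaxDegreeTwo {n : ℕ} (G : Graph n) (G? : Decidable G) (G-sym : Symmetric G)
                    (G-irrefl : Irreflexive _≡_ G) (G-deg : MaxDegree≤2 G) where

  Reach-trans : ∀ {a b c} → Reach G a b → Reach G b c → Reach G a c
  Reach-trans here       r′ = r′
  Reach-trans (step g r) r′ = step g (Reach-trans r r′)

  Reach-sym : ∀ {a b} → Reach G a b → Reach G b a
  Reach-sym here       = here
  Reach-sym (step g r) = Reach-trans (Reach-sym r) (step (G-sym g) here)

  Linked : ∀ {k} → (Fin (suc k) → Fin n) → Set
  Linked f = ∀ {i j} → Succ i j → G (f i) (f j)

  reach-from-zero : ∀ {k} {f : Fin (suc k) → Fin n} → Linked f → ∀ j → Reach G (f zero) (f j)
  reach-from-zero _ zero = here
  reach-from-zero {suc k} linked (suc j) =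
    step (linked {zero} {suc zero} refl) (reach-from-zero (linked ∘ cong suc) j)

  record Path : Set where
    constructor mkPath
    field
      len      : ℕ
      vertex   : Fin (suc len) → Fin n
      vertex-injective : Injective _≡_ _≡_ vertex
      linked   : Linked vertex
  open Path

  head last : Path → Fin n
  head p = vertex p zero
  last p = vertex p (fromℕ (len p))

  _∈ᵥ_ : Fin n → Path → Set
  u ∈ᵥ p = ∃ λ i → vertex p i ≡ u

  _⊆ᵥ_ : Path → Path → Set
  p ⊆ᵥ q = ∀ {u} → u ∈ᵥ p → u ∈ᵥ q

  Saturated : Path → Fin n → Set
  Saturated p x = ∀ u → G x u → u ∈ᵥ p

  trivial : Fin n → Path
  trivial v = mkPath 0 (λ _ → v) (λ { {zero} {zero} _ → refl }) (λ { {zero} {zero} () })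

  prepend : (p : Path) (u : Fin n) → (∀ i → vertex p i ≢ u) → G u (head p) → Path
  prepend (mkPath k f f-inj linked) u fresh u-head = mkPath (suc k) f′ f′-inj linked′
    where
    f′ : Fin (suc (suc k)) → Fin n
    f′ zero    = u
    f′ (suc i) = f i
    f′-inj : Injective _≡_ _≡_ f′
    f′-inj {zero}  {zero}  _ = refl
    f′-inj {zero}  {suc j} e = ⊥-elim (fresh j (sym e))
    f′-inj {suc i} {zero}  e = ⊥-elim (fresh i e)
    f′-inj {suc i} {suc j} e = cong suc (f-inj e)
    linked′ : Linked f′
    linked′ {zero}  {suc j} e with toℕ-injective {i = j} {j = zero} (ℕₚ.suc-injective e)
    ... | refl = u-head
    linked′ {suc i} {suc j} e = linked (ℕₚ.suc-injective e)

  prepend-⊇ : ∀ p u fresh u-head → p ⊆ᵥ prepend p u fresh u-head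
  prepend-⊇ p u fresh u-head (i , e) = suc i , e

  reverse : Path → Path
  reverse (mkPath k f f-inj linked) = mkPath k (f ∘ opposite) rev-inj (G-sym ∘ linked ∘ opposite-Succ)
    where
    rev-inj : Injective _≡_ _≡_ (f ∘ opposite)
    rev-inj {i} {j} e = begin
      i                     ≡⟨ opposite-involutive i ⟨
      opposite (opposite i) ≡⟨ cong opposite (f-inj e) ⟩
      opposite (opposite j) ≡⟨ opposite-involutive j ⟩
      j                     ∎
      where open ≡-Reasoning

  reverse-⊇ : ∀ p → p ⊆ᵥ reverse p
  reverse-⊇ p (i , e) = opposite i , trans (cong (vertex p) (opposite-involutive i)) e

  last-reverse : ∀ p → last (reverse p) ≡ head p
  last-reverse p = cong (vertex p) (opposite-fromℕ (len p))

  saturated-or-extendable : (p : Path) →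
    Saturated p (head p) ⊎ ∃ λ u → (∀ i → vertex p i ≢ u) × G u (head p)
  saturated-or-extendable p with any? (λ u → G? (head p) u ×-dec ¬? (any? λ i → vertex p i ≟ u))
  ... | yes (u , head-u , off) = inj₂ (u , (λ i e → off (i , e)) , G-sym head-u)
  ... | no ¬extendable = inj₁ λ u head-u →
          decidable-stable (any? λ i → vertex p i ≟ u) (λ off → ¬extendable (u , head-u , off))

  record HeadSaturatedExtension (p : Path) : Set where
    constructor extension
    field
      extended       : Path
      head-saturated : Saturated extended (head extended)
      covers         : p ⊆ᵥ extended
      same-last      : last extended ≡ last p

  -- Each step adds a vertex to an injective path, so n steps of fuel suffice.
  extend : (fuel : ℕ) (p : Path) → n ≤ fuel + suc (len p) → HeadSaturatedExtension p
  extend fuel p room with saturated-or-extendable p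
  ... | inj₁ saturated = extension p saturated (λ u∈p → u∈p) refl
  ... | inj₂ (u , fresh , u-head) with fuel
  ...   | zero = ⊥-elim (<-irrefl refl (≤-trans (injective⇒≤ (vertex-injective p′)) room))
    where p′ = prepend p u fresh u-head
  ...   | suc fuel′ with extend fuel′ (prepend p u fresh u-head) (subst (n ≤_) (sym (+-suc fuel′ _)) room)
  ...     | extension q saturated covers same-last =
              extension q saturated (covers ∘ prepend-⊇ p u fresh u-head) same-last

  record MaximalPath : Set where
    constructor maximal
    field
      path           : Path
      head-saturated : Saturated path (head path)
      last-saturated : Saturated path (last path)

  -- Extend at the head, turn the path round, and extend at the new head.
  maximal-path-through : ∀ v → Σ MaximalPath λ m → v ∈ᵥ MaximalPath.path m
  maximal-path-through v =
    maximal q₂ head-saturated₂ last-saturated₂ , q₁⊆q₂ (covers₁ (zero , refl))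
    where
    open HeadSaturatedExtension (extend n (trivial v) (m≤m+n n 1))
      renaming (extended to q₁; head-saturated to head-saturated₁; covers to covers₁)
    open HeadSaturatedExtension (extend n (reverse q₁) (m≤m+n n _))
      renaming (extended to q₂; head-saturated to head-saturated₂; covers to covers₂; same-last to same-last₂)
    q₁⊆q₂ : q₁ ⊆ᵥ q₂
    q₁⊆q₂ = covers₂ ∘ reverse-⊇ q₁
    last-saturated₂ : Saturated q₂ (last q₂)
    last-saturated₂ u last-u =
      q₁⊆q₂ (head-saturated₁ u (subst (λ x → G x u) (trans same-last₂ (last-reverse q₁)) last-u))

  module _ (m : MaximalPath) where
    open MaximalPath m
    open Path path renaming (len to k; vertex to f; vertex-injective to f-inj; linked to f-linked)

    inner-neighbours : ∀ {i i⁻ i⁺ u} → Succ i⁻ i → Succ i i⁺ → G (f i) u → u ≡ f i⁻ ⊎ u ≡ f i⁺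
    inner-neighbours {i⁻ = i⁻} i⁻→i i→i⁺ i-u with G-deg (G-sym (f-linked i⁻→i)) (f-linked i→i⁺) i-u
    ... | inj₁ f⁻≡f⁺       = ⊥-elim (m≢1+n+m (toℕ i⁻) {1}
                                (trans (cong toℕ (f-inj f⁻≡f⁺)) (trans i→i⁺ (cong suc i⁻→i))))
    ... | inj₂ (inj₁ f⁻≡u) = inj₁ (sym f⁻≡u)
    ... | inj₂ (inj₂ f⁺≡u) = inj₂ (sym f⁺≡u)

    neighbour-on-path : ∀ i u → G (f i) u → u ∈ᵥ path
    neighbour-on-path i u i-u with position i
    ... | first refl = head-saturated u i-u
    ... | final refl = last-saturated u i-u
    ... | inner i⁻ i⁺ i⁻→i i→i⁺ with inner-neighbours i⁻→i i→i⁺ i-u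
    ...   | inj₁ u≡f⁻ = i⁻ , sym u≡f⁻
    ...   | inj₂ u≡f⁺ = i⁺ , sym u≡f⁺

    reach⇒on-path : ∀ {a u} → Reach G a u → a ∈ᵥ path → u ∈ᵥ path
    reach⇒on-path here       a∈p       = a∈p
    reach⇒on-path (step g r) (i , refl) = reach⇒on-path r (neighbour-on-path i _ g)

    enumerates : ∀ {v} → v ∈ᵥ path → EnumeratesComponent G v f
    enumerates (i , refl) = f-inj , λ u → mk⇔ (λ r → reach⇒on-path r (i , refl)) from
      where
      from : ∀ {u} → u ∈ᵥ path → Reach G (f i) u
      from (j , refl) = Reach-trans (Reach-sym (reach-from-zero f-linked i)) (reach-from-zero f-linked j)

    Consec⇒adjacent : ∀ {i j} → Consec i j → G (f i) (f j)
    Consec⇒adjacent (inj₁ i→j) = f-linked i→j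
    Consec⇒adjacent (inj₂ j→i) = G-sym (f-linked j→i)

    inner-adjacent⇒Consec : ∀ {i i⁻ i⁺ j} → Succ i⁻ i → Succ i i⁺ → G (f i) (f j) → Consec i j
    inner-adjacent⇒Consec i⁻→i i→i⁺ i-j with inner-neighbours i⁻→i i→i⁺ i-j
    ... | inj₁ fj≡f⁻ rewrite f-inj fj≡f⁻ = inj₂ i⁻→i
    ... | inj₂ fj≡f⁺ rewrite f-inj fj≡f⁺ = inj₁ i→i⁺

    adjacent⇒Consec⊎Closing : ∀ i j → G (f i) (f j) → Consec i j ⊎ Closing i j
    adjacent⇒Consec⊎Closing i j i-j with position i | position j
    ... | inner _ _ i⁻→i i→i⁺ | _ = inj₁ (inner-adjacent⇒Consec i⁻→i i→i⁺ i-j)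
    ... | _ | inner _ _ j⁻→j j→j⁺ = inj₁ (swap (inner-adjacent⇒Consec j⁻→j j→j⁺ (G-sym i-j)))
    ... | first refl | first refl = ⊥-elim (G-irrefl refl i-j)
    ... | final refl | final refl = ⊥-elim (G-irrefl refl i-j)
    ... | first refl | final refl = inj₂ (inj₁ (refl , toℕ-fromℕ k))
    ... | final refl | first refl = inj₂ (inj₂ (toℕ-fromℕ k , refl))

    Closing⇒adjacent⇔ : ∀ {i j} → Closing i j → G (f i) (f j) ⇔ G (head path) (last path)
    Closing⇒adjacent⇔ c with Closing⇒endpoints c
    ... | inj₁ (refl , refl) = mk⇔ (λ g → g) (λ g → g)
    ... | inj₂ (refl , refl) = mk⇔ G-sym G-sym

    component-shape : ∀ {v} → v ∈ᵥ path → ComponentIsPath G v ⊎ ComponentIsCycle G v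
    component-shape v∈p with G? (head path) (last path) ×-dec 2 ≤? k
    ... | yes (ends , 2≤k) = inj₂ (k , 2≤k , f , enumerates v∈p , λ i j →
            mk⇔ (adjacent⇒Consec⊎Closing i j)
                [ Consec⇒adjacent , (λ c → Equivalence.from (Closing⇒adjacent⇔ c) ends) ])
    ... | no ¬cycle = inj₁ (k , f , enumerates v∈p , λ i j → mk⇔ (adjacent⇒Consec i j) Consec⇒adjacent)
      where
      adjacent⇒Consec : ∀ i j → G (f i) (f j) → Consec i j
      adjacent⇒Consec i j i-j with adjacent⇒Consec⊎Closing i j i-j | 2 ≤? k
      ... | inj₁ c | _       = c
      ... | inj₂ c | yes 2≤k = ⊥-elim (¬cycle (Equivalence.to (Closing⇒adjacent⇔ c) i-j , 2≤k))
      ... | inj₂ c | no 2≰k  = Closing⇒Consec (≰⇒> 2≰k) (λ { refl → G-irrefl refl i-j }) c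

  components-are-paths-or-cycles : ∀ v → ComponentIsPath G v ⊎ ComponentIsCycle G v
  components-are-paths-or-cycles v =
    component-shape (proj₁ (maximal-path-through v)) (proj₂ (maximal-path-through v))

proposition2p1 : ∀ (n : ℕ) (D : Digraph n) → Is22 D →
    ∀ (v : Fin n) → ComponentIsPath (CCE D) v ⊎ ComponentIsCycle (CCE D) v
proposition2p1 n D D-22 =
  MaxDegreeTwo.components-are-paths-or-cycles (CCE D) (CCE? D) (CCE-sym D) (CCE-irrefl D) (CCE-maxDegree≤2 D D-22)
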